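{- Let $C=(C_h)_{h\in\mathbb{Z}}$ be a complete folding curve, let $n\in\mathbb{N}$ and $i,j\in\mathbb{Z}$. Then $(C_{j+1},\dots,C_{j+88n})$ contains a curve (block of consecutive segments) which is parallel to $(C_{i+1},\dots,C_{i+n})$ and another curve which is opposite to $(C_{i+1},\dots,C_{i+n})$.
   Context: All sequences take values in $\{+1,-1\}$. For $S=(a_1,\dots,a_n)$ write $\overline{S}=(-a_n,\dots,-a_1)$. The $n$-folding sequences are defined recursively: the only $0$-folding sequence is the empty sequence, and the $(n+1)$-folding sequences are exactly $(\overline{S},+1,S)$ and $(\overline{S},-1,S)$ with $S$ an $n$-folding sequence. A subword of a sequence $(b_k)$ is a block $(b_{h+1},\dots,b_{h+m})$. A complete folding sequence is a sequence $(a_k)_{k\in\mathbb{Z}}$ each finite subword of which is a subword of some $n$-folding sequence. A segment is an oriented unit edge of $\mathbb{Z}^2$. A complete curve is a sequence $(C_i)_{i\in\mathbb{Z}}$ of segments such that the terminal point of $C_i$ is the initial point of $C_{i+1}$, consecutive supports are perpendicular, and all supports are pairwise distinct; its associated sequence is $(\eta_i)_{i\in\mathbb{Z}}$ with $\eta_i=+1$ (resp. $-1$) if one turns left (resp. right) from $C_i$ to $C_{i+1}$. A complete folding curve is a complete curve whose associated sequence is a complete folding sequence. Two finite curves (sequences of oriented segments) are parallel (resp. opposite) if one is the image of the other, segment by segment and with orientations, under a translation (resp. a rotation of angle $\pi$) of the plane. -}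

module Defs where

open import Data.Nat as ℕ using (ℕ; zero; suc)
open import Data.Integer as ℤ using (ℤ; +_; -_)
open import Data.Product using (Σ; ∃; _×_; _,_)
open import Data.List using (List; []; _∷_; _++_; map; reverse)
open import Relation.Binary.PropositionalEquality using (_≡_; _≢_)
open import Data.Sum using (_⊎_)
open import Relation.Nullary using (¬_)

data Sgn : Set where
  plus minus : Sgn

neg : Sgn → Sgn
neg plus  = minus
neg minus = plus

bar : List Sgn → List Sgn
bar S = reverse (map neg S)

data IsFolding : ℕ → List Sgn → Set where
  fold-zero : IsFolding zero []
  fold-suc  : ∀ {n S} (e : Sgn) → IsFolding n S → IsFolding (suc n) (bar S ++ e ∷ S)

Subword : List Sgn → List Sgn → Set
Subword w s = Σ (List Sgn) λ p → Σ (List Sgn) λ q → p ++ w ++ q ≡ s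

-- the block (b_{h+1}, …, b_{h+m}) of a ℤ-indexed sequence
block : {A : Set} → (ℤ → A) → ℤ → ℕ → List A
block b h zero    = []
block b h (suc m) = b (h ℤ.+ + 1) ∷ block b (h ℤ.+ + 1) m

IsCompleteFolding : (ℤ → Sgn) → Set
IsCompleteFolding a =
  ∀ (h : ℤ) (m : ℕ) → Σ ℕ λ n → Σ (List Sgn) λ S → IsFolding n S × Subword (block a h m) S

Point : Set
Point = ℤ × ℤ

_⊕_ : Point → Point → Point
(a , b) ⊕ (c , d) = (a ℤ.+ c , b ℤ.+ d)

_⊖_ : Point → Point → Point
(a , b) ⊖ (c , d) = (a ℤ.- c , b ℤ.- d)

data Dir : Set where
  east north west south : Dir

dvec : Dir → Point
dvec east  = (+ 1 , + 0)
dvec north = (+ 0 , + 1)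
dvec west  = (- + 1 , + 0)
dvec south = (+ 0 , - + 1)

rotL : Dir → Dir
rotL east  = north
rotL north = west
rotL west  = south
rotL south = east

opp : Dir → Dir
opp d = rotL (rotL d)

-- an oriented unit edge: initial point and direction
record Segment : Set where
  constructor seg
  field
    start : Point
    dir   : Dir

open Segment public

terminal : Segment → Point
terminal s = start s ⊕ dvec (dir s)

-- supports (the underlying unoriented edges) coincide
SameSupport : Segment → Segment → Set
SameSupport s t = (start s ≡ start t × terminal s ≡ terminal t)
                ⊎ (start s ≡ terminal t × terminal s ≡ start t)

data Horizontal : Dir → Set where
  h-east : Horizontal east
  h-west : Horizontal west

data Vertical : Dir → Set where
  v-north : Vertical north
  v-south : Vertical south

Perp : Segment → Segment → Set
Perp s t = (Horizontal (dir s) × Vertical (dir t)) ⊎ (Vertical (dir s) × Horizontal (dir t))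

record IsCompleteCurve (C : ℤ → Segment) : Set where
  field
    connected     : ∀ i → terminal (C i) ≡ start (C (i ℤ.+ + 1))
    perpendicular : ∀ i → Perp (C i) (C (i ℤ.+ + 1))
    distinct      : ∀ i j → i ≢ j → ¬ SameSupport (C i) (C j)

-- turning sign from direction d to direction e:
-- +1 if e is d rotated left by π/2, otherwise -1 (a right turn when perpendicular)
turn : Dir → Dir → Sgn
turn east  north = plus
turn north west  = plus
turn west  south = plus
turn south east  = plus
turn _     _     = minus

assoc : (ℤ → Segment) → ℤ → Sgn
assoc C i = turn (dir (C i)) (dir (C (i ℤ.+ + 1)))

IsCompleteFoldingCurve : (ℤ → Segment) → Set
IsCompleteFoldingCurve C = IsCompleteCurve C × IsCompleteFolding (assoc C)

translate : Point → Segment → Segment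
translate v (seg p d) = seg (p ⊕ v) d

-- rotation of angle π mapping point p to c - p (c ∈ ℤ²; every rotation by π
-- mapping ℤ² into ℤ² has this form); the oriented segment p→q goes to (c-p)→(c-q)
rotπ : Point → Segment → Segment
rotπ c (seg p d) = seg (c ⊖ p) (opp d)

Parallel : List Segment → List Segment → Set
Parallel A B = Σ Point λ v → map (translate v) A ≡ B

Opposite : List Segment → List Segment → Set
Opposite A B = Σ Point λ c → map (rotπ c) A ≡ B

module Submission where

-- Directions form the group ℤ/4 (rotation _⊙_), and along a curve the direction
-- of a segment is the initial direction rotated by the heading, i.e. the sum of
-- the quarter turns taken so far.  The folding function foldSeq c with folding
-- instructions c interleaves an alternating sequence with foldSeq (c ∘ suc).
-- Cutting ℕ into blocks of length 2 ^ m ≈ n, the turns inside block u and the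
-- heading relative to the coarse folding function at u depend only on the parity
-- of u (self-similarity); among any 40 consecutive blocks there are two of a
-- prescribed parity and coarse value whose coarse headings differ by π.  This
-- gives the combinatorial main lemma (main-lemma): the n headings after p recur
-- near any s, both unchanged and rotated by π.  Since every folding sequence is an
-- initial segment of a folding function, the turns of a complete folding curve
-- follow a folding function on every finite window (folding-window), so the main
-- lemma yields blocks with equal resp. opposite directions (rotated-copies), and
-- such blocks are parallel resp. opposite (parallel-blocks, opposite-blocks).

open import Defs
open import Data.Nat using (ℕ; _+_; _*_; _≤_)
open import Data.Integer using (ℤ) renaming (_+_ to _+ℤ_; +_ to pos)
open import Data.Product using (Σ; _×_)

open import Data.Nat using (zero; suc; _<_; _^_; s≤s; z≤n; NonZero; _/_; _%_)
open import Data.Nat.DivMod using (m%n<n; m≡m%n+[m/n]*n)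
import Data.Nat.Properties as ℕP
open import Data.Nat.Tactic.RingSolver using (solve-∀)
import Data.Integer as ℤ
import Data.Integer.Properties as ℤP
import Data.Integer.Tactic.RingSolver as ℤSolver
open import Data.Product using (_,_; proj₁; proj₂)
open import Data.Sum using (_⊎_; inj₁; inj₂)
open import Data.Empty using (⊥-elim)
open import Data.List using (List; []; _∷_; _++_; map; length)
import Data.List.Properties as LP
open import Function using (_∘_)
open import Relation.Binary.Definitions using (tri<; tri≈; tri>)
open import Relation.Binary.PropositionalEquality

-- The directions form the cyclic group ℤ/4; `a ⊙ d` rotates d by the angle of a
-- (east = 0, north = π/2, …).  In particular `opp d` is definitionally `west ⊙ d`.

infixr 6 _⊙_

_⊙_ : Dir → Dir → Dir
east  ⊙ d = d
north ⊙ d = rotL d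
west  ⊙ d = rotL (rotL d)
south ⊙ d = rotL (rotL (rotL d))

rotL⁴ : ∀ d → rotL (rotL (rotL (rotL d))) ≡ d
rotL⁴ east  = refl
rotL⁴ north = refl
rotL⁴ west  = refl
rotL⁴ south = refl

⊙-rotLˡ : ∀ a d → rotL a ⊙ d ≡ rotL (a ⊙ d)
⊙-rotLˡ east  d = refl
⊙-rotLˡ north d = refl
⊙-rotLˡ west  d = refl
⊙-rotLˡ south d = sym (rotL⁴ d)

⊙-rotLʳ : ∀ a d → a ⊙ rotL d ≡ rotL (a ⊙ d)
⊙-rotLʳ east  d = refl
⊙-rotLʳ north d = refl
⊙-rotLʳ west  d = refl
⊙-rotLʳ south d = refl

⊙-identityʳ : ∀ a → a ⊙ east ≡ a
⊙-identityʳ east  = refl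
⊙-identityʳ north = refl
⊙-identityʳ west  = refl
⊙-identityʳ south = refl

⊙-assoc : ∀ a b d → (a ⊙ b) ⊙ d ≡ a ⊙ (b ⊙ d)
⊙-assoc east  b d = refl
⊙-assoc north b d = ⊙-rotLˡ b d
⊙-assoc west  b d = trans (⊙-rotLˡ (rotL b) d) (cong rotL (⊙-rotLˡ b d))
⊙-assoc south b d =
  trans (⊙-rotLˡ (rotL (rotL b)) d) (cong rotL (trans (⊙-rotLˡ (rotL b) d) (cong rotL (⊙-rotLˡ b d))))

rotL-comm : ∀ a b → a ⊙ b ≡ b ⊙ a → a ⊙ rotL b ≡ rotL b ⊙ a
rotL-comm a b e = trans (⊙-rotLʳ a b) (trans (cong rotL e) (sym (⊙-rotLˡ b a)))

-- Every direction is an iterated left rotation of east, which commutes with everything.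
⊙-comm : ∀ a b → a ⊙ b ≡ b ⊙ a
⊙-comm a east  = ⊙-identityʳ a
⊙-comm a north = rotL-comm a east (⊙-identityʳ a)
⊙-comm a west  = rotL-comm a north (rotL-comm a east (⊙-identityʳ a))
⊙-comm a south = rotL-comm a west (rotL-comm a north (rotL-comm a east (⊙-identityʳ a)))

⊙-swap : ∀ a b d → a ⊙ (b ⊙ d) ≡ b ⊙ (a ⊙ d)
⊙-swap a b d = trans (sym (⊙-assoc a b d)) (trans (cong (_⊙ d) (⊙-comm a b)) (⊙-assoc b a d))

inverse : Dir → Dir
inverse east  = east
inverse north = south
inverse west  = west
inverse south = north

⊙-inverseˡ : ∀ a → inverse a ⊙ a ≡ east
⊙-inverseˡ east  = refl
⊙-inverseˡ north = refl
⊙-inverseˡ west  = refl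
⊙-inverseˡ south = refl

⊙-cancelˡ : ∀ a {x y} → a ⊙ x ≡ a ⊙ y → x ≡ y
⊙-cancelˡ a {x} {y} e = begin
  x                     ≡˘⟨ cong (_⊙ x) (⊙-inverseˡ a) ⟩
  (inverse a ⊙ a) ⊙ x   ≡⟨ ⊙-assoc (inverse a) a x ⟩
  inverse a ⊙ (a ⊙ x)   ≡⟨ cong (inverse a ⊙_) e ⟩
  inverse a ⊙ (a ⊙ y)   ≡˘⟨ ⊙-assoc (inverse a) a y ⟩
  (inverse a ⊙ a) ⊙ y   ≡⟨ cong (_⊙ y) (⊙-inverseˡ a) ⟩
  y                     ∎
  where open ≡-Reasoning

⊙-cancelʳ : ∀ a {x y} → x ⊙ a ≡ y ⊙ a → x ≡ y
⊙-cancelʳ a {x} {y} e = ⊙-cancelˡ a (trans (⊙-comm a x) (trans e (⊙-comm y a)))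

⊙-interchange : ∀ x y a b → x ⊙ (y ⊙ (a ⊙ b)) ≡ (y ⊙ a) ⊙ (x ⊙ b)
⊙-interchange x y a b = begin
  x ⊙ (y ⊙ (a ⊙ b))   ≡⟨ ⊙-swap x y (a ⊙ b) ⟩
  y ⊙ (x ⊙ (a ⊙ b))   ≡⟨ cong (y ⊙_) (⊙-swap x a b) ⟩
  y ⊙ (a ⊙ (x ⊙ b))   ≡˘⟨ ⊙-assoc y a (x ⊙ b) ⟩
  (y ⊙ a) ⊙ (x ⊙ b)   ∎
  where open ≡-Reasoning

data HalfTurn : Dir → Set where
  no-turn   : HalfTurn east
  half-turn : HalfTurn west

halfTurn-⊙ : ∀ {a b} → HalfTurn a → HalfTurn b → HalfTurn (a ⊙ b)
halfTurn-⊙ no-turn   hb        = hb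
halfTurn-⊙ half-turn no-turn   = half-turn
halfTurn-⊙ half-turn half-turn = no-turn

halfTurn-twice : ∀ {g} → HalfTurn g → ∀ d → g ⊙ (g ⊙ d) ≡ d
halfTurn-twice no-turn   d = refl
halfTurn-twice half-turn d = rotL⁴ d

turnDir : Sgn → Dir
turnDir plus  = north
turnDir minus = south

turnDir-neg : ∀ x → turnDir (neg x) ⊙ turnDir x ≡ east
turnDir-neg plus  = refl
turnDir-neg minus = refl

turnDir-twice : ∀ x → turnDir x ⊙ turnDir x ≡ west
turnDir-twice plus  = refl
turnDir-twice minus = refl

turnDir-pair : ∀ x y → HalfTurn (turnDir y ⊙ turnDir x)
turnDir-pair plus  plus  = half-turn
turnDir-pair plus  minus = no-turn
turnDir-pair minus plus  = no-turn
turnDir-pair minus minus = half-turn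

heading : (ℕ → Sgn) → ℕ → Dir
heading a zero    = east
heading a (suc k) = turnDir (a k) ⊙ heading a k

heading-cong : ∀ {a b} k → (∀ t → t < k → a t ≡ b t) → heading a k ≡ heading b k
heading-cong zero    e = refl
heading-cong (suc k) e =
  cong₂ (λ x h → turnDir x ⊙ h) (e k (ℕP.n<1+n k)) (heading-cong k (λ t t<k → e t (ℕP.m<n⇒m<1+n t<k)))

heading-+ : ∀ a m k → heading a (m + k) ≡ heading (λ t → a (m + t)) k ⊙ heading a m
heading-+ a m zero    = cong (heading a) (ℕP.+-identityʳ m)
heading-+ a m (suc k) = begin
  heading a (m + suc k)                               ≡⟨ cong (heading a) (ℕP.+-suc m k) ⟩
  turnDir (a (m + k)) ⊙ heading a (m + k)             ≡⟨ cong (turnDir (a (m + k)) ⊙_) (heading-+ a m k) ⟩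
  turnDir (a (m + k)) ⊙ (heading a′ k ⊙ heading a m)  ≡˘⟨ ⊙-assoc (turnDir (a (m + k))) (heading a′ k) _ ⟩
  heading a′ (suc k) ⊙ heading a m                    ∎
  where
  open ≡-Reasoning
  a′ : ℕ → Sgn
  a′ = λ t → a (m + t)

heading-copy : ∀ a p q g l → (∀ t → t < l → a (q + t) ≡ a (p + t)) →
  heading a q ≡ g ⊙ heading a p → heading a (q + l) ≡ g ⊙ heading a (p + l)
heading-copy a p q g l same start = begin
  heading a (q + l)                                          ≡⟨ heading-+ a q l ⟩
  heading (λ t → a (q + t)) l ⊙ heading a q                  ≡⟨ cong₂ _⊙_ (heading-cong l same) start ⟩
  heading (λ t → a (p + t)) l ⊙ (g ⊙ heading a p)            ≡⟨ ⊙-swap (heading (λ t → a (p + t)) l) g (heading a p) ⟩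
  g ⊙ (heading (λ t → a (p + t)) l ⊙ heading a p)            ≡˘⟨ cong (g ⊙_) (heading-+ a p l) ⟩
  g ⊙ heading a (p + l)                                      ∎
  where open ≡-Reasoning

two-suc : ∀ v → 2 * suc v ≡ suc (suc (2 * v))
two-suc = solve-∀

heading-even : ∀ a v → HalfTurn (heading a (2 * v))
heading-even a zero    = no-turn
heading-even a (suc v) =
  subst (λ m → HalfTurn (heading a m)) (sym (two-suc v))
    (subst HalfTurn (⊙-assoc (turnDir (a (suc (2 * v)))) (turnDir (a (2 * v))) _)
      (halfTurn-⊙ (turnDir-pair (a (2 * v)) (a (suc (2 * v)))) (heading-even a v)))

heading-parity : ∀ a k v → Σ Dir λ g → HalfTurn g × heading a (k + 2 * v) ≡ g ⊙ heading a k
heading-parity a k v = heading (λ t → a (k + t)) (2 * v) , heading-even (λ t → a (k + t)) v , heading-+ a k (2 * v)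

alt : Sgn → ℕ → Sgn
alt s zero    = s
alt s (suc j) = neg (alt s j)

neg-involutive : ∀ s → neg (neg s) ≡ s
neg-involutive plus  = refl
neg-involutive minus = refl

plus-two-suc : ∀ u v → u + 2 * suc v ≡ suc (suc (u + 2 * v))
plus-two-suc = solve-∀

alt-periodic : ∀ s u v → alt s (u + 2 * v) ≡ alt s u
alt-periodic s u zero    = cong (alt s) (ℕP.+-identityʳ u)
alt-periodic s u (suc v) = trans (cong (alt s) (plus-two-suc u v)) (trans (neg-involutive _) (alt-periodic s u v))

alt-even : ∀ s v → alt s (2 * v) ≡ s
alt-even s v = alt-periodic s 0 v

heading-alt-2+ : ∀ s j → heading (alt s) (2 + j) ≡ heading (alt s) j
heading-alt-2+ s j = begin
  turnDir (neg x) ⊙ (turnDir x ⊙ heading (alt s) j)   ≡˘⟨ ⊙-assoc (turnDir (neg x)) (turnDir x) _ ⟩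
  (turnDir (neg x) ⊙ turnDir x) ⊙ heading (alt s) j   ≡⟨ cong (_⊙ heading (alt s) j) (turnDir-neg x) ⟩
  heading (alt s) j                                    ∎
  where
  open ≡-Reasoning
  x : Sgn
  x = alt s j

heading-alt-periodic : ∀ s u v → heading (alt s) (u + 2 * v) ≡ heading (alt s) u
heading-alt-periodic s u zero    = cong (heading (alt s)) (ℕP.+-identityʳ u)
heading-alt-periodic s u (suc v) =
  trans (cong (heading (alt s)) (plus-two-suc u v)) (trans (heading-alt-2+ s (u + 2 * v)) (heading-alt-periodic s u v))

data Parity : ℕ → Set where
  even : ∀ j → Parity (2 * j)
  odd  : ∀ j → Parity (suc (2 * j))

parity : ∀ k → Parity k
parity zero = even 0
parity (suc k) with parity k
... | even j = odd j
... | odd j  = subst Parity (two-suc j) (even (suc j))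

SameParity : ℕ → ℕ → Set
SameParity x y = Σ ℕ λ v → y ≡ x + 2 * v ⊎ x ≡ y + 2 * v

same-parity-double : ∀ a b → SameParity (2 * a) (2 * b)
same-parity-double a b with ℕP.≤-total a b
... | inj₁ a≤b = let (v , a+v≡b) = ℕP.m≤n⇒∃[o]m+o≡n a≤b in
  v , inj₁ (trans (cong (2 *_) (sym a+v≡b)) (ℕP.*-distribˡ-+ 2 a v))
... | inj₂ b≤a = let (v , b+v≡a) = ℕP.m≤n⇒∃[o]m+o≡n b≤a in
  v , inj₂ (trans (cong (2 *_) (sym b+v≡a)) (ℕP.*-distribˡ-+ 2 b v))

same-parity-suc : ∀ {x y} → SameParity x y → SameParity (suc x) (suc y)
same-parity-suc (v , inj₁ e) = v , inj₁ (cong suc e)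
same-parity-suc (v , inj₂ e) = v , inj₂ (cong suc e)

heading-same-parity : ∀ a {x P} → SameParity x P → Σ Dir λ g → HalfTurn g × heading a x ≡ g ⊙ heading a P
heading-same-parity a {_} {P} (v , inj₂ refl) = heading-parity a P v
heading-same-parity a {x} (v , inj₁ refl) with heading-parity a x v
... | g , half , e = g , half , sym (trans (cong (g ⊙_) e) (halfTurn-twice half (heading a x)))

interleave : {A : Set} → (ℕ → A) → (ℕ → A) → ℕ → A
interleave e o zero    = e 0
interleave e o (suc k) = interleave o (e ∘ suc) k

interleave-even : ∀ {A : Set} (e o : ℕ → A) j → interleave e o (2 * j) ≡ e j
interleave-even e o zero    = refl
interleave-even e o (suc j) = trans (cong (interleave e o) (two-suc j)) (interleave-even (e ∘ suc) (o ∘ suc) j)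

interleave-odd : ∀ {A : Set} (e o : ℕ → A) j → interleave e o (suc (2 * j)) ≡ o j
interleave-odd e o j = interleave-even o (e ∘ suc) j

heading-interleave : ∀ e o j → heading (interleave e o) (2 * j) ≡ heading e j ⊙ heading o j
heading-interleave e o zero    = refl
heading-interleave e o (suc j) = begin
  heading I (2 * suc j)
    ≡⟨ cong (heading I) (two-suc j) ⟩
  turnDir (I (suc (2 * j))) ⊙ (turnDir (I (2 * j)) ⊙ heading I (2 * j))
    ≡⟨ cong₂ (λ x y → turnDir x ⊙ (turnDir y ⊙ heading I (2 * j))) (interleave-odd e o j) (interleave-even e o j) ⟩
  turnDir (o j) ⊙ (turnDir (e j) ⊙ heading I (2 * j))
    ≡⟨ cong (λ h → turnDir (o j) ⊙ (turnDir (e j) ⊙ h)) (heading-interleave e o j) ⟩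
  turnDir (o j) ⊙ (turnDir (e j) ⊙ (heading e j ⊙ heading o j))
    ≡⟨ ⊙-interchange (turnDir (o j)) (turnDir (e j)) (heading e j) (heading o j) ⟩
  heading e (suc j) ⊙ heading o (suc j)
    ∎
  where
  open ≡-Reasoning
  I : ℕ → Sgn
  I = interleave e o

-- The folding function with folding instructions c : ℕ → Sgn is the sequence
-- interleaving the alternating sequence alt (c 0) with the folding function of
-- the remaining instructions c ∘ suc.  As this recursion is not structural, the
-- function is defined with a fuel argument, sufficient for indices below it.
foldingWith : ℕ → (ℕ → Sgn) → ℕ → Sgn
foldingWith zero    c = λ _ → plus
foldingWith (suc f) c = interleave (alt (c 0)) (foldingWith f (c ∘ suc))

fuel-irrelevant : ∀ f g c k → k < f → k < g → foldingWith f c k ≡ foldingWith g c k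
fuel-irrelevant (suc f) (suc g) c k k<f k<g with parity k
... | even j = trans (interleave-even (alt (c 0)) _ j) (sym (interleave-even (alt (c 0)) _ j))
... | odd j  = begin
  foldingWith (suc f) c (suc (2 * j))  ≡⟨ interleave-odd (alt (c 0)) _ j ⟩
  foldingWith f (c ∘ suc) j            ≡⟨ fuel-irrelevant f g (c ∘ suc) j (half< k<f) (half< k<g) ⟩
  foldingWith g (c ∘ suc) j            ≡˘⟨ interleave-odd (alt (c 0)) _ j ⟩
  foldingWith (suc g) c (suc (2 * j))  ∎
  where
  open ≡-Reasoning
  half< : ∀ {h} → suc (2 * j) < suc h → j < h
  half< k<h = ℕP.≤-trans (s≤s (ℕP.m≤m+n j (j + 0))) (ℕP.≤-pred k<h)

-- The folding function itself is kept opaque: from here on it is only used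
-- through its defining recursion foldSeq-unfold.
opaque
  foldSeq : (ℕ → Sgn) → ℕ → Sgn
  foldSeq c k = foldingWith (suc k) c k

  foldSeq-unfold : ∀ c k → foldSeq c k ≡ interleave (alt (c 0)) (foldSeq (c ∘ suc)) k
  foldSeq-unfold c k with parity k
  ... | even j = trans (interleave-even (alt (c 0)) _ j) (sym (interleave-even (alt (c 0)) _ j))
  ... | odd j  = trans (interleave-odd (alt (c 0)) _ j)
      (trans (fuel-irrelevant (suc (2 * j)) (suc j) (c ∘ suc) j (s≤s (ℕP.m≤m+n j _)) (ℕP.n<1+n j))
        (sym (interleave-odd (alt (c 0)) _ j)))

foldSeq-even : ∀ c j → foldSeq c (2 * j) ≡ alt (c 0) j
foldSeq-even c j = trans (foldSeq-unfold c (2 * j)) (interleave-even (alt (c 0)) _ j)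

foldSeq-odd : ∀ c j → foldSeq c (suc (2 * j)) ≡ foldSeq (c ∘ suc) j
foldSeq-odd c j = trans (foldSeq-unfold c (suc (2 * j))) (interleave-odd (alt (c 0)) _ j)

heading-foldSeq-even : ∀ c j →
  heading (foldSeq c) (2 * j) ≡ heading (alt (c 0)) j ⊙ heading (foldSeq (c ∘ suc)) j
heading-foldSeq-even c j =
  trans (heading-cong (2 * j) (λ t _ → foldSeq-unfold c t)) (heading-interleave (alt (c 0)) _ j)

heading-foldSeq-odd : ∀ c j →
  heading (foldSeq c) (suc (2 * j)) ≡ heading (alt (c 0)) (suc j) ⊙ heading (foldSeq (c ∘ suc)) j
heading-foldSeq-odd c j = begin
  turnDir (foldSeq c (2 * j)) ⊙ heading (foldSeq c) (2 * j)
    ≡⟨ cong₂ (λ x h → turnDir x ⊙ h) (foldSeq-even c j) (heading-foldSeq-even c j) ⟩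
  turnDir (alt (c 0) j) ⊙ (heading (alt (c 0)) j ⊙ heading (foldSeq (c ∘ suc)) j)
    ≡˘⟨ ⊙-assoc (turnDir (alt (c 0) j)) (heading (alt (c 0)) j) _ ⟩
  heading (alt (c 0)) (suc j) ⊙ heading (foldSeq (c ∘ suc)) j
    ∎
  where open ≡-Reasoning

drop : ℕ → (ℕ → Sgn) → ℕ → Sgn
drop m c t = c (m + t)

scale-even : ∀ q x r → 2 * q * x + 2 * r ≡ 2 * (q * x + r)
scale-even = solve-∀

scale-odd : ∀ q x r → 2 * q * x + suc (2 * r) ≡ suc (2 * (q * x + r))
scale-odd = solve-∀

regroup : ∀ q u v r → q * (u + 2 * v) + r ≡ (q * u + r) + 2 * (q * v)
regroup = solve-∀

scale-unit : ∀ x → 1 * x + 0 ≡ x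
scale-unit = solve-∀

halve-< : ∀ {r q} → 2 * r < 2 * q → r < q
halve-< {r} {q} = ℕP.*-cancelˡ-< 2 r q

odd≢even : ∀ a b → suc (2 * a) ≢ 2 * b
odd≢even a       zero    ()
odd≢even zero    (suc b) e = ℕP.0≢1+n (ℕP.suc-injective (trans e (two-suc b)))
odd≢even (suc a) (suc b) e =
  odd≢even a b (ℕP.suc-injective (ℕP.suc-injective (trans (cong suc (sym (two-suc a))) (trans e (two-suc b)))))

foldSeq-scaled-even : ∀ m c x r → foldSeq c (2 ^ suc m * x + 2 * r) ≡ alt (c 0) (2 ^ m * x + r)
foldSeq-scaled-even m c x r = trans (cong (foldSeq c) (scale-even (2 ^ m) x r)) (foldSeq-even c (2 ^ m * x + r))

foldSeq-scaled-odd : ∀ m c x r → foldSeq c (2 ^ suc m * x + suc (2 * r)) ≡ foldSeq (c ∘ suc) (2 ^ m * x + r)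
foldSeq-scaled-odd m c x r = trans (cong (foldSeq c) (scale-odd (2 ^ m) x r)) (foldSeq-odd c (2 ^ m * x + r))

heading-scaled-even : ∀ m c x r → heading (foldSeq c) (2 ^ suc m * x + 2 * r)
  ≡ heading (alt (c 0)) (2 ^ m * x + r) ⊙ heading (foldSeq (c ∘ suc)) (2 ^ m * x + r)
heading-scaled-even m c x r =
  trans (cong (heading (foldSeq c)) (scale-even (2 ^ m) x r)) (heading-foldSeq-even c (2 ^ m * x + r))

heading-scaled-odd : ∀ m c x r → heading (foldSeq c) (2 ^ suc m * x + suc (2 * r))
  ≡ heading (alt (c 0)) (suc (2 ^ m * x + r)) ⊙ heading (foldSeq (c ∘ suc)) (2 ^ m * x + r)
heading-scaled-odd m c x r =
  trans (cong (heading (foldSeq c)) (scale-odd (2 ^ m) x r)) (heading-foldSeq-odd c (2 ^ m * x + r))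

foldSeq-block-periodic : ∀ m c u v r → suc r < 2 ^ m →
  foldSeq c (2 ^ m * (u + 2 * v) + r) ≡ foldSeq c (2 ^ m * u + r)
foldSeq-block-periodic zero    c u v r (s≤s ())
foldSeq-block-periodic (suc m) c u v r r< with parity r
... | even r′ = begin
  foldSeq c (2 ^ suc m * (u + 2 * v) + 2 * r′)   ≡⟨ foldSeq-scaled-even m c (u + 2 * v) r′ ⟩
  alt (c 0) (2 ^ m * (u + 2 * v) + r′)           ≡⟨ cong (alt (c 0)) (regroup (2 ^ m) u v r′) ⟩
  alt (c 0) ((2 ^ m * u + r′) + 2 * (2 ^ m * v)) ≡⟨ alt-periodic (c 0) (2 ^ m * u + r′) (2 ^ m * v) ⟩
  alt (c 0) (2 ^ m * u + r′)                     ≡˘⟨ foldSeq-scaled-even m c u r′ ⟩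
  foldSeq c (2 ^ suc m * u + 2 * r′)             ∎
  where open ≡-Reasoning
... | odd r′ = begin
  foldSeq c (2 ^ suc m * (u + 2 * v) + suc (2 * r′)) ≡⟨ foldSeq-scaled-odd m c (u + 2 * v) r′ ⟩
  foldSeq (c ∘ suc) (2 ^ m * (u + 2 * v) + r′)       ≡⟨ foldSeq-block-periodic m (c ∘ suc) u v r′ r′< ⟩
  foldSeq (c ∘ suc) (2 ^ m * u + r′)                 ≡˘⟨ foldSeq-scaled-odd m c u r′ ⟩
  foldSeq c (2 ^ suc m * u + suc (2 * r′))           ∎
  where
  open ≡-Reasoning
  r′< : suc r′ < 2 ^ m
  r′< = halve-< (subst (_< 2 ^ suc m) (sym (two-suc r′)) r<)

foldSeq-block-last : ∀ m c u r → suc r ≡ 2 ^ m → foldSeq c (2 ^ m * u + r) ≡ foldSeq (drop m c) u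
foldSeq-block-last zero    c u zero    refl = cong (foldSeq c) (scale-unit u)
foldSeq-block-last zero    c u (suc r) ()
foldSeq-block-last (suc m) c u r last with parity r
... | even r′ = ⊥-elim (odd≢even r′ (2 ^ m) last)
... | odd r′  = trans (foldSeq-scaled-odd m c u r′) (foldSeq-block-last m (c ∘ suc) u r′ r′-last)
  where
  r′-last : suc r′ ≡ 2 ^ m
  r′-last = ℕP.*-cancelˡ-≡ (suc r′) (2 ^ m) 2 (trans (two-suc r′) last)

block-step : ∀ {A A′ X X′ Y Y′} → A ≡ A′ → X ⊙ Y′ ≡ X′ ⊙ Y → (A ⊙ X) ⊙ Y′ ≡ (A′ ⊙ X′) ⊙ Y
block-step {A} {_} {X} {X′} {Y} {Y′} refl e =
  trans (⊙-assoc A X Y′) (trans (cong (A ⊙_) e) (sym (⊙-assoc A X′ Y)))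

heading-block : ∀ m c u v r → r < 2 ^ m →
  heading (foldSeq c) (2 ^ m * (u + 2 * v) + r) ⊙ heading (foldSeq (drop m c)) u
  ≡ heading (foldSeq c) (2 ^ m * u + r) ⊙ heading (foldSeq (drop m c)) (u + 2 * v)
heading-block zero c u v zero r< = begin
  heading (foldSeq c) (1 * (u + 2 * v) + 0) ⊙ heading (foldSeq c) u
    ≡⟨ cong (λ x → heading (foldSeq c) x ⊙ heading (foldSeq c) u) (scale-unit (u + 2 * v)) ⟩
  heading (foldSeq c) (u + 2 * v) ⊙ heading (foldSeq c) u
    ≡⟨ ⊙-comm (heading (foldSeq c) (u + 2 * v)) (heading (foldSeq c) u) ⟩
  heading (foldSeq c) u ⊙ heading (foldSeq c) (u + 2 * v)
    ≡˘⟨ cong (λ x → heading (foldSeq c) x ⊙ heading (foldSeq c) (u + 2 * v)) (scale-unit u) ⟩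
  heading (foldSeq c) (1 * u + 0) ⊙ heading (foldSeq c) (u + 2 * v)
    ∎
  where open ≡-Reasoning
heading-block zero c u v (suc r) (s≤s ())
heading-block (suc m) c u v r r< with parity r
... | even r′ =
  subst₂ (λ x y → x ⊙ Hd u ≡ y ⊙ Hd (u + 2 * v))
    (sym (heading-scaled-even m c (u + 2 * v) r′)) (sym (heading-scaled-even m c u r′))
    (block-step (trans (cong (heading (alt (c 0))) (regroup (2 ^ m) u v r′))
                       (heading-alt-periodic (c 0) (2 ^ m * u + r′) (2 ^ m * v)))
                (heading-block m (c ∘ suc) u v r′ (halve-< r<)))
  where
  Hd : ℕ → Dir
  Hd = heading (foldSeq (drop (suc m) c))
... | odd r′ =
  subst₂ (λ x y → x ⊙ Hd u ≡ y ⊙ Hd (u + 2 * v))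
    (sym (heading-scaled-odd m c (u + 2 * v) r′)) (sym (heading-scaled-odd m c u r′))
    (block-step (trans (cong (λ x → heading (alt (c 0)) (suc x)) (regroup (2 ^ m) u v r′))
                       (heading-alt-periodic (c 0) (suc (2 ^ m * u + r′)) (2 ^ m * v)))
                (heading-block m (c ∘ suc) u v r′ (halve-< (ℕP.<-trans (ℕP.n<1+n _) r<))))
  where
  Hd : ℕ → Dir
  Hd = heading (foldSeq (drop (suc m) c))

foldSeq-block-same : ∀ m c u P r → SameParity u P → suc r < 2 ^ m →
  foldSeq c (2 ^ m * u + r) ≡ foldSeq c (2 ^ m * P + r)
foldSeq-block-same m c u _ r (v , inj₁ refl) r< = sym (foldSeq-block-periodic m c u v r r<)
foldSeq-block-same m c _ P r (v , inj₂ refl) r< = foldSeq-block-periodic m c P v r r<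

heading-block-same : ∀ m c u P r → SameParity u P → r < 2 ^ m →
  heading (foldSeq c) (2 ^ m * u + r) ⊙ heading (foldSeq (drop m c)) P
  ≡ heading (foldSeq c) (2 ^ m * P + r) ⊙ heading (foldSeq (drop m c)) u
heading-block-same m c u _ r (v , inj₁ refl) r< = sym (heading-block m c u v r r<)
heading-block-same m c _ P r (v , inj₂ refl) r< = heading-block m c P v r r<

block-word : ∀ m c u P → SameParity u P → foldSeq (drop m c) u ≡ foldSeq (drop m c) P →
  ∀ x → suc (suc x) ≤ 2 ^ m + 2 ^ m → foldSeq c (2 ^ m * u + x) ≡ foldSeq c (2 ^ m * P + x)
block-word m c u P same agree x x< with ℕP.<-cmp (suc x) (2 ^ m)
... | tri< inside _ _ = foldSeq-block-same m c u P x same inside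
... | tri≈ _ last _   =
  trans (foldSeq-block-last m c u x last) (trans agree (sym (foldSeq-block-last m c P x last)))
... | tri> _ _ beyond with ℕP.m≤n⇒∃[o]m+o≡n (ℕP.≤-pred beyond)
... | y , refl = begin
  foldSeq c (2 ^ m * u + (2 ^ m + y))   ≡⟨ cong (foldSeq c) (next-block (2 ^ m) u y) ⟩
  foldSeq c (2 ^ m * suc u + y)         ≡⟨ foldSeq-block-same m c (suc u) (suc P) y (same-parity-suc same) y< ⟩
  foldSeq c (2 ^ m * suc P + y)         ≡˘⟨ cong (foldSeq c) (next-block (2 ^ m) P y) ⟩
  foldSeq c (2 ^ m * P + (2 ^ m + y))   ∎
  where
  open ≡-Reasoning
  next-block : ∀ Q u y → Q * u + (Q + y) ≡ Q * suc u + y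
  next-block = solve-∀
  y< : suc y < 2 ^ m
  y< = ℕP.+-cancelˡ-≤ (2 ^ m) _ _
         (subst (_≤ 2 ^ m + 2 ^ m) (sym (trans (ℕP.+-suc (2 ^ m) (suc y)) (cong suc (ℕP.+-suc (2 ^ m) y)))) x<)

block-heading : ∀ m c u P r g → SameParity u P → r < 2 ^ m →
  heading (foldSeq (drop m c)) u ≡ g ⊙ heading (foldSeq (drop m c)) P →
  heading (foldSeq c) (2 ^ m * u + r) ≡ g ⊙ heading (foldSeq c) (2 ^ m * P + r)
block-heading m c u P r g same r< rotated = ⊙-cancelʳ (Hd P) (begin
  A ⊙ Hd P         ≡⟨ heading-block-same m c u P r same r< ⟩
  B ⊙ Hd u         ≡⟨ cong (B ⊙_) rotated ⟩
  B ⊙ (g ⊙ Hd P)   ≡˘⟨ ⊙-assoc B g (Hd P) ⟩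
  (B ⊙ g) ⊙ Hd P   ≡⟨ cong (_⊙ Hd P) (⊙-comm B g) ⟩
  (g ⊙ B) ⊙ Hd P   ∎)
  where
  open ≡-Reasoning
  Hd : ℕ → Dir
  Hd = heading (foldSeq (drop m c))
  A B : Dir
  A = heading (foldSeq c) (2 ^ m * u + r)
  B = heading (foldSeq c) (2 ^ m * P + r)

alt-hits : ∀ s τ b → Σ ℕ λ d → d ≤ 1 × alt s (b + d) ≡ τ
alt-hits s τ b with alt s b in eq | τ
... | plus  | plus  = 0 , z≤n , trans (cong (alt s) (ℕP.+-identityʳ b)) eq
... | minus | minus = 0 , z≤n , trans (cong (alt s) (ℕP.+-identityʳ b)) eq
... | plus  | minus = 1 , s≤s z≤n , trans (cong (alt s) (ℕP.+-comm b 1)) (cong neg eq)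
... | minus | plus  = 1 , s≤s z≤n , trans (cong (alt s) (ℕP.+-comm b 1)) (cong neg eq)

equal-pair-even : ∀ c b → Σ ℕ λ d → d ≤ 1 ×
  foldSeq c (2 * (2 * (b + d))) ≡ foldSeq c (suc (2 * (2 * (b + d))))
equal-pair-even c b with alt-hits ((c ∘ suc) 0) (c 0) b
... | d , d≤1 , hit = d , d≤1 , (begin
  foldSeq c (2 * (2 * (b + d)))        ≡⟨ foldSeq-even c (2 * (b + d)) ⟩
  alt (c 0) (2 * (b + d))              ≡⟨ alt-even (c 0) (b + d) ⟩
  c 0                                  ≡˘⟨ hit ⟩
  alt (c 1) (b + d)                    ≡˘⟨ foldSeq-even (c ∘ suc) (b + d) ⟩
  foldSeq (c ∘ suc) (2 * (b + d))      ≡˘⟨ foldSeq-odd c (2 * (b + d)) ⟩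
  foldSeq c (suc (2 * (2 * (b + d))))  ∎)
  where open ≡-Reasoning

equal-pair-odd : ∀ c b → Σ ℕ λ d → d ≤ 1 ×
  foldSeq c (suc (2 * (2 * (b + d)))) ≡ foldSeq c (suc (suc (2 * (2 * (b + d)))))
equal-pair-odd c b with alt-hits ((c ∘ suc) 0) (neg (c 0)) b
... | d , d≤1 , hit = d , d≤1 , (begin
  foldSeq c (suc (2 * (2 * (b + d))))        ≡⟨ foldSeq-odd c (2 * (b + d)) ⟩
  foldSeq (c ∘ suc) (2 * (b + d))            ≡⟨ foldSeq-even (c ∘ suc) (b + d) ⟩
  alt (c 1) (b + d)                          ≡⟨ hit ⟩
  neg (c 0)                                  ≡˘⟨ cong neg (alt-even (c 0) (b + d)) ⟩
  alt (c 0) (suc (2 * (b + d)))              ≡˘⟨ foldSeq-even c (suc (2 * (b + d))) ⟩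
  foldSeq c (2 * suc (2 * (b + d)))          ≡⟨ cong (foldSeq c) (two-suc (2 * (b + d))) ⟩
  foldSeq c (suc (suc (2 * (2 * (b + d)))))  ∎)
  where open ≡-Reasoning

EqualNeighbours : (ℕ → Sgn) → ℕ → Set
EqualNeighbours c j = Σ ℕ λ e → e ≤ 3 × foldSeq c (j + 2 * e) ≡ foldSeq c (suc (j + 2 * e))

equal-neighbours-at : ∀ c j (y e : ℕ → ℕ) → (∀ {d} → d ≤ 1 → e d ≤ 3) → (∀ d → j + 2 * e d ≡ y d) →
  (Σ ℕ λ d → d ≤ 1 × foldSeq c (y d) ≡ foldSeq c (suc (y d))) → EqualNeighbours c j
equal-neighbours-at c j y e e≤3 j+2e≡y (d , d≤1 , eq) =
  e d , e≤3 d≤1 , subst (λ z → foldSeq c z ≡ foldSeq c (suc z)) (sym (j+2e≡y d)) eq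

double≤2 : ∀ {d} → d ≤ 1 → 2 * d ≤ 2
double≤2 z≤n       = z≤n
double≤2 (s≤s z≤n) = s≤s (s≤s z≤n)

double≤3 : ∀ {d} → d ≤ 1 → 2 * d ≤ 3
double≤3 d≤1 = ℕP.≤-trans (double≤2 d≤1) (ℕP.n≤1+n 2)

double+1≤3 : ∀ {d} → d ≤ 1 → suc (2 * d) ≤ 3
double+1≤3 d≤1 = s≤s (double≤2 d≤1)

equal-neighbours : ∀ c j → EqualNeighbours c j
equal-neighbours c j with parity j
... | even i with parity i
...   | even b = equal-neighbours-at c (2 * (2 * b)) (λ d → 2 * (2 * (b + d))) (λ d → 2 * d) double≤3
                   (offset b) (equal-pair-even c b)
  where
  offset : ∀ b d → 2 * (2 * b) + 2 * (2 * d) ≡ 2 * (2 * (b + d))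
  offset = solve-∀
...   | odd b  = equal-neighbours-at c (2 * suc (2 * b)) (λ d → 2 * (2 * (suc b + d))) (λ d → suc (2 * d)) double+1≤3
                   (offset b) (equal-pair-even c (suc b))
  where
  offset : ∀ b d → 2 * suc (2 * b) + 2 * suc (2 * d) ≡ 2 * (2 * (suc b + d))
  offset = solve-∀
equal-neighbours c j | odd i with parity i
...   | even b = equal-neighbours-at c (suc (2 * (2 * b))) (λ d → suc (2 * (2 * (b + d)))) (λ d → 2 * d) double≤3
                   (offset b) (equal-pair-odd c b)
  where
  offset : ∀ b d → suc (2 * (2 * b)) + 2 * (2 * d) ≡ suc (2 * (2 * (b + d)))
  offset = solve-∀
...   | odd b  = equal-neighbours-at c (suc (2 * suc (2 * b))) (λ d → suc (2 * (2 * (suc b + d))))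
                   (λ d → suc (2 * d)) double+1≤3
                   (offset b) (equal-pair-odd c (suc b))
  where
  offset : ∀ b d → suc (2 * suc (2 * b)) + 2 * suc (2 * d) ≡ suc (2 * (2 * (suc b + d)))
  offset = solve-∀

OppositePair : (ℕ → Sgn) → Sgn → ℕ → ℕ → Set
OppositePair c σ x y =
  foldSeq c x ≡ σ × foldSeq c y ≡ σ × heading (foldSeq c) y ≡ west ⊙ heading (foldSeq c) x

half-turn-between : ∀ c w → foldSeq (c ∘ suc) w ≡ foldSeq (c ∘ suc) (suc w) →
  heading (foldSeq c) (2 * (2 + w)) ≡ west ⊙ heading (foldSeq c) (2 * w)
half-turn-between c w same = begin
  heading (foldSeq c) (2 * (2 + w))     ≡⟨ heading-foldSeq-even c (2 + w) ⟩
  A (2 + w) ⊙ (T₁ ⊙ (T₀ ⊙ H′ w))        ≡⟨ cong₂ _⊙_ (heading-alt-2+ (c 0) w) (sym (⊙-assoc T₁ T₀ (H′ w))) ⟩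
  A w ⊙ ((T₁ ⊙ T₀) ⊙ H′ w)              ≡⟨ cong (λ z → A w ⊙ (z ⊙ H′ w)) two-equal-turns ⟩
  A w ⊙ (west ⊙ H′ w)                   ≡⟨ ⊙-swap (A w) west (H′ w) ⟩
  west ⊙ (A w ⊙ H′ w)                   ≡˘⟨ cong (west ⊙_) (heading-foldSeq-even c w) ⟩
  west ⊙ heading (foldSeq c) (2 * w)    ∎
  where
  open ≡-Reasoning
  A H′ : ℕ → Dir
  A = heading (alt (c 0))
  H′ = heading (foldSeq (c ∘ suc))
  T₀ T₁ : Dir
  T₀ = turnDir (foldSeq (c ∘ suc) w)
  T₁ = turnDir (foldSeq (c ∘ suc) (suc w))
  two-equal-turns : T₁ ⊙ T₀ ≡ west
  two-equal-turns = trans (cong (λ z → turnDir z ⊙ T₀) (sym same)) (turnDir-twice (foldSeq (c ∘ suc) w))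

half-up : ∀ u₀ → Σ ℕ λ J → u₀ ≤ 2 * J × 2 * J ≤ suc u₀
half-up u₀ with parity u₀
... | even J = J , ℕP.≤-refl , ℕP.n≤1+n _
... | odd J  = suc J , subst (suc (2 * J) ≤_) (sym (two-suc J)) (ℕP.n≤1+n _)
                     , ℕP.≤-reflexive (two-suc J)

half-down : ∀ u₀ → Σ ℕ λ J → 2 * J ≤ u₀ × u₀ ≤ suc (2 * J)
half-down u₀ with parity u₀
... | even J = J , ℕP.≤-refl , ℕP.n≤1+n _
... | odd J  = J , ℕP.n≤1+n _ , ℕP.≤-refl

EvenTwins : (ℕ → Sgn) → Sgn → ℕ → Set
EvenTwins c σ u₀ = Σ ℕ λ w → u₀ ≤ 2 * w × 2 * (2 + w) < u₀ + 20 × OppositePair c σ (2 * w) (2 * (2 + w))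

OddTwins : (ℕ → Sgn) → Sgn → ℕ → Set
OddTwins c σ u₀ = Σ ℕ λ w → u₀ ≤ suc (2 * (2 * w)) × suc (2 * (2 * (2 + w))) < u₀ + 40 ×
  OppositePair c σ (suc (2 * (2 * w))) (suc (2 * (2 * (2 + w))))

twins-even : ∀ c σ u₀ → EvenTwins c σ u₀
twins-even c σ u₀ with half-up u₀
... | J , u₀≤2J , 2J≤1+u₀ with alt-hits (c 0) σ J
... | δ , δ≤1 , hit with equal-neighbours (c ∘ suc) (J + δ)
... | e , e≤3 , same = w , u₀≤2w , bound , value w w-value , value (2 + w) (trans (neg-involutive _) w-value)
                      , half-turn-between c w same
  where
  w : ℕ
  w = J + δ + 2 * e
  u₀≤2w : u₀ ≤ 2 * w
  u₀≤2w = ℕP.≤-trans u₀≤2J (ℕP.*-monoʳ-≤ 2 (ℕP.≤-trans (ℕP.m≤m+n J δ) (ℕP.m≤m+n (J + δ) (2 * e))))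
  expand : ∀ J δ e → suc (2 * (2 + (J + δ + 2 * e))) ≡ 2 * J + (5 + (2 * δ + 4 * e))
  expand = solve-∀
  bound : 2 * (2 + w) < u₀ + 20
  bound = subst₂ _≤_ (sym (expand J δ e)) (sym (ℕP.+-suc u₀ 19))
    (ℕP.+-mono-≤ 2J≤1+u₀ (ℕP.+-monoʳ-≤ 5 (ℕP.+-mono-≤ (ℕP.*-monoʳ-≤ 2 δ≤1) (ℕP.*-monoʳ-≤ 4 e≤3))))
  w-value : alt (c 0) w ≡ σ
  w-value = trans (alt-periodic (c 0) (J + δ) e) hit
  value : ∀ x → alt (c 0) x ≡ σ → foldSeq c (2 * x) ≡ σ
  value x h = trans (foldSeq-even c x) h

-- Odd twins come from even twins of the remaining folding function: the
-- alternating part of the heading is the same at both positions.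
twins-odd : ∀ c σ u₀ → OddTwins c σ u₀
twins-odd c σ u₀ with half-down u₀
... | J , 2J≤u₀ , u₀≤1+2J = from-even (twins-even (c ∘ suc) σ J)
  where
  from-even : EvenTwins (c ∘ suc) σ J → OddTwins c σ u₀
  from-even (w , J≤2w , bound′ , x-value , y-value , opposite) =
    w , ℕP.≤-trans u₀≤1+2J (s≤s (ℕP.*-monoʳ-≤ 2 J≤2w)) , bound
      , trans (foldSeq-odd c (2 * w)) x-value , trans (foldSeq-odd c (2 * (2 + w))) y-value , heading-y
    where
    H′ : ℕ → Dir
    H′ = heading (foldSeq (c ∘ suc))
    A : Dir
    A = heading (alt (c 0)) (suc (2 * w))
    double : ∀ w → suc (2 * (2 + w)) ≡ suc (2 * w) + 2 * 2
    double = solve-∀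
    scale : ∀ w J → 2 * suc (2 * (2 + w)) ≤ 2 * (J + 20) → suc (suc (2 * (2 * (2 + w)))) ≤ 2 * J + 40
    scale w J h = subst₂ _≤_ (two-suc (2 * (2 + w))) (ℕP.*-distribˡ-+ 2 J 20) h
    bound : suc (2 * (2 * (2 + w))) < u₀ + 40
    bound = ℕP.≤-trans (scale w J (ℕP.*-monoʳ-≤ 2 bound′)) (ℕP.+-monoˡ-≤ 40 2J≤u₀)
    heading-y : heading (foldSeq c) (suc (2 * (2 * (2 + w)))) ≡ west ⊙ heading (foldSeq c) (suc (2 * (2 * w)))
    heading-y = begin
      heading (foldSeq c) (suc (2 * (2 * (2 + w))))          ≡⟨ heading-foldSeq-odd c (2 * (2 + w)) ⟩
      heading (alt (c 0)) (suc (2 * (2 + w))) ⊙ H′ (2 * (2 + w))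
        ≡⟨ cong₂ _⊙_ (trans (cong (heading (alt (c 0))) (double w)) (heading-alt-periodic (c 0) (suc (2 * w)) 2)) opposite ⟩
      A ⊙ (west ⊙ H′ (2 * w))                                  ≡⟨ ⊙-swap A west (H′ (2 * w)) ⟩
      west ⊙ (A ⊙ H′ (2 * w))                                  ≡˘⟨ cong (west ⊙_) (heading-foldSeq-odd c (2 * w)) ⟩
      west ⊙ heading (foldSeq c) (suc (2 * (2 * w)))          ∎
      where open ≡-Reasoning

record Twins (c : ℕ → Sgn) (σ : Sgn) (P u₀ : ℕ) : Set where
  field
    x y      : ℕ
    x-window : u₀ ≤ x × x < u₀ + 40
    y-window : u₀ ≤ y × y < u₀ + 40
    x-parity : SameParity x P
    y-parity : SameParity y P
    pair     : OppositePair c σ x y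

twins : ∀ c σ P u₀ → Twins c σ P u₀
twins c σ P u₀ with parity P
... | even P′ = from-even (twins-even c σ u₀)
  where
  widen : ∀ {z} → z < u₀ + 20 → z < u₀ + 40
  widen z< = ℕP.≤-trans z< (ℕP.+-monoʳ-≤ u₀ (ℕP.m≤m+n 20 20))
  from-even : EvenTwins c σ u₀ → Twins c σ (2 * P′) u₀
  from-even (w , u₀≤x , y<u₀+20 , pair) = record
    { x = 2 * w ; y = 2 * (2 + w)
    ; x-window = u₀≤x , widen (ℕP.≤-<-trans x≤y y<u₀+20)
    ; y-window = ℕP.≤-trans u₀≤x x≤y , widen y<u₀+20
    ; x-parity = same-parity-double w P′ ; y-parity = same-parity-double (2 + w) P′
    ; pair = pair }
    where
    x≤y : 2 * w ≤ 2 * (2 + w)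
    x≤y = ℕP.*-monoʳ-≤ 2 (ℕP.m≤n+m w 2)
... | odd P′ = from-odd (twins-odd c σ u₀)
  where
  from-odd : OddTwins c σ u₀ → Twins c σ (suc (2 * P′)) u₀
  from-odd (w , u₀≤x , y<u₀+40 , pair) = record
    { x = suc (2 * (2 * w)) ; y = suc (2 * (2 * (2 + w)))
    ; x-window = u₀≤x , ℕP.≤-<-trans x≤y y<u₀+40
    ; y-window = ℕP.≤-trans u₀≤x x≤y , y<u₀+40
    ; x-parity = same-parity-suc (same-parity-double (2 * w) P′)
    ; y-parity = same-parity-suc (same-parity-double (2 * (2 + w)) P′)
    ; pair = pair }
    where
    x≤y : suc (2 * (2 * w)) ≤ suc (2 * (2 * (2 + w)))
    x≤y = s≤s (ℕP.*-monoʳ-≤ 2 (ℕP.*-monoʳ-≤ 2 (ℕP.m≤n+m w 2)))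

power-of-two-between : ∀ n → Σ ℕ λ m → suc n ≤ 2 ^ m × 2 ^ m ≤ 2 * suc n
power-of-two-between zero = 0 , ℕP.≤-refl , s≤s z≤n
power-of-two-between (suc n) with power-of-two-between n
... | m , n< , ≤2n with ℕP.m≤n⇒m<n∨m≡n n<
...   | inj₁ n+1<  = m , n+1< , ℕP.≤-trans ≤2n (ℕP.*-monoʳ-≤ 2 (ℕP.n≤1+n (suc n)))
...   | inj₂ n+1≡ = suc m , subst (suc (suc n) ≤_) (cong (2 *_) n+1≡) (ℕP.≤-trans (s≤s (s≤s (ℕP.m≤m+n n _)))
                                                     (ℕP.≤-reflexive (sym (two-suc n))))
                          , ℕP.*-monoʳ-≤ 2 (ℕP.≤-trans (ℕP.≤-reflexive (sym n+1≡)) (ℕP.n≤1+n (suc n)))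

divide : ∀ m p → Σ ℕ λ P → Σ ℕ λ r → r < 2 ^ m × p ≡ 2 ^ m * P + r
divide m p = p / 2 ^ m , p % 2 ^ m , m%n<n p (2 ^ m) ,
  trans (m≡m%n+[m/n]*n p (2 ^ m))
    (trans (ℕP.+-comm (p % 2 ^ m) _) (cong (_+ p % 2 ^ m) (ℕP.*-comm (p / 2 ^ m) (2 ^ m))))
  where
  instance
    2^m≢0 : NonZero (2 ^ m)
    2^m≢0 = ℕP.m^n≢0 2 m

Copy : (ℕ → Sgn) → ℕ → ℕ → ℕ → Dir → Set
Copy c n p s g = Σ ℕ λ k → k + n ≤ 88 * n ×
  (∀ l → l < n → heading (foldSeq c) (s + k + suc l) ≡ g ⊙ heading (foldSeq c) (p + suc l))

module CopiesAtScale (c : ℕ → Sgn) (n m : ℕ) (n≤2^m : n ≤ 2 ^ m) (2^m≤2n : 2 ^ m ≤ 2 * n) where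

  Q : ℕ
  Q = 2 ^ m
  H : ℕ → Sgn
  H = foldSeq (drop m c)

  copy-length : ∀ k → k ≤ 41 * Q → k + n ≤ 88 * n
  copy-length k k≤ = begin
    k + n              ≤⟨ ℕP.+-monoˡ-≤ n (ℕP.≤-trans k≤ (ℕP.*-monoʳ-≤ 41 2^m≤2n)) ⟩
    41 * (2 * n) + n   ≡⟨ regroup′ n ⟩
    83 * n             ≤⟨ ℕP.*-monoˡ-≤ n (ℕP.m≤m+n 83 5) ⟩
    88 * n             ∎
    where
    open ℕP.≤-Reasoning
    regroup′ : ∀ n → 41 * (2 * n) + n ≡ 83 * n
    regroup′ = solve-∀

  copy-from-block : ∀ P r S r′ u g → r < Q → r′ < Q → suc S ≤ u → u < suc S + 40 →
    SameParity u P → H u ≡ H P → heading H u ≡ g ⊙ heading H P → Copy c n (Q * P + r) (Q * S + r′) g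
  copy-from-block P r S r′ u g r< r′< S<u u< same agree rotated = k , copy-length k k≤ , copy
    where
    s q : ℕ
    s = Q * S + r′
    q = Q * u + r
    s≤q : s ≤ q
    s≤q = begin
      Q * S + r′   ≤⟨ ℕP.+-monoʳ-≤ (Q * S) (ℕP.<⇒≤ r′<) ⟩
      Q * S + Q    ≡⟨ ℕP.+-comm (Q * S) Q ⟩
      Q + Q * S    ≡˘⟨ ℕP.*-suc Q S ⟩
      Q * suc S    ≤⟨ ℕP.*-monoʳ-≤ Q S<u ⟩
      Q * u        ≤⟨ ℕP.m≤m+n (Q * u) r ⟩
      q            ∎
      where open ℕP.≤-Reasoning
    k : ℕ
    k = proj₁ (ℕP.m≤n⇒∃[o]m+o≡n s≤q)
    s+k≡q : s + k ≡ q
    s+k≡q = proj₂ (ℕP.m≤n⇒∃[o]m+o≡n s≤q)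
    window-end : ∀ Q S → Q * (suc S + 40) ≡ Q * S + 41 * Q
    window-end = solve-∀
    k≤ : k ≤ 41 * Q
    k≤ = ℕP.<⇒≤ (ℕP.+-cancelˡ-< s k (41 * Q) (begin-strict
      s + k              ≡⟨ s+k≡q ⟩
      Q * u + r          <⟨ ℕP.+-monoʳ-< (Q * u) r< ⟩
      Q * u + Q          ≡⟨ trans (ℕP.+-comm (Q * u) Q) (sym (ℕP.*-suc Q u)) ⟩
      Q * suc u          ≤⟨ ℕP.*-monoʳ-≤ Q u< ⟩
      Q * (suc S + 40)   ≡⟨ window-end Q S ⟩
      Q * S + 41 * Q     ≤⟨ ℕP.+-monoˡ-≤ (41 * Q) (ℕP.m≤m+n (Q * S) r′) ⟩
      s + 41 * Q         ∎))
      where open ℕP.≤-Reasoning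
    same-turns : ∀ l → l ≤ n → ∀ t → t < l → foldSeq c (q + t) ≡ foldSeq c (Q * P + r + t)
    same-turns l l≤n t t<l =
      subst₂ (λ x y → foldSeq c x ≡ foldSeq c y) (sym (ℕP.+-assoc (Q * u) r t)) (sym (ℕP.+-assoc (Q * P) r t))
        (block-word m c u P same agree (r + t)
          (subst (_≤ Q + Q) (ℕP.+-suc (suc r) t) (ℕP.+-mono-≤ r< (ℕP.≤-trans t<l (ℕP.≤-trans l≤n n≤2^m)))))
    copy : ∀ l → l < n → heading (foldSeq c) (s + k + suc l) ≡ g ⊙ heading (foldSeq c) (Q * P + r + suc l)
    copy l l<n = trans (cong (λ x → heading (foldSeq c) (x + suc l)) s+k≡q)
      (heading-copy (foldSeq c) (Q * P + r) q g (suc l) (same-turns (suc l) l<n)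
        (block-heading m c u P r g same r< rotated))

main-lemma : ∀ c n p s → Copy c n p s east × Copy c n p s west
main-lemma c zero p s = (0 , z≤n , λ l ()) , (0 , z≤n , λ l ())
main-lemma c (suc n) p s with power-of-two-between n
... | m , n<2^m , 2^m≤2n with divide m p | divide m s
... | P , r , r< , refl | S , r′ , r′< , refl = from-twins (twins (drop m c) (H P) P (suc S))
  where
  open CopiesAtScale c (suc n) m n<2^m 2^m≤2n
  from-twins : Twins (drop m c) (H P) P (suc S) →
    Copy c (suc n) (Q * P + r) (Q * S + r′) east × Copy c (suc n) (Q * P + r) (Q * S + r′) west
  from-twins twin with heading-same-parity H (Twins.x-parity twin)
  ... | _ , rotation , x-rotated = result rotation x-rotated
    where
    open Twins twin
    x-value : H x ≡ H P
    x-value = proj₁ pair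
    y-value : H y ≡ H P
    y-value = proj₁ (proj₂ pair)
    y-opposite : heading H y ≡ west ⊙ heading H x
    y-opposite = proj₂ (proj₂ pair)
    copy-at : ∀ u g → suc S ≤ u × u < suc S + 40 → SameParity u P → H u ≡ H P →
      heading H u ≡ g ⊙ heading H P → Copy c (suc n) (Q * P + r) (Q * S + r′) g
    copy-at u g (S<u , u<) = copy-from-block P r S r′ u g r< r′< S<u u<
    -- Of the two blocks x and y, one is rotated by 0 and the other by π.
    result : ∀ {g} → HalfTurn g → heading H x ≡ g ⊙ heading H P →
      Copy c (suc n) (Q * P + r) (Q * S + r′) east × Copy c (suc n) (Q * P + r) (Q * S + r′) west
    result no-turn   x-rotated = copy-at x east x-window x-parity x-value x-rotated
                               , copy-at y west y-window y-parity y-value (trans y-opposite (cong (west ⊙_) x-rotated))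
    result half-turn x-rotated = copy-at y east y-window y-parity y-value
                                   (trans y-opposite (trans (cong (west ⊙_) x-rotated) (halfTurn-twice half-turn _)))
                               , copy-at x west x-window x-parity x-value x-rotated

-- The k-th term of a finite sequence.
nth : List Sgn → ℕ → Sgn
nth []       k       = plus
nth (x ∷ xs) zero    = x
nth (x ∷ xs) (suc k) = nth xs k

interleaveAlt : Sgn → List Sgn → List Sgn
interleaveAlt x []      = x ∷ []
interleaveAlt x (s ∷ S) = x ∷ s ∷ interleaveAlt (neg x) S

alt-alt : ∀ x a b → alt (alt x a) b ≡ alt x (b + a)
alt-alt x a zero    = refl
alt-alt x a (suc b) = cong neg (alt-alt x a b)

interleaveAlt-++ : ∀ y A e B →
  interleaveAlt y (A ++ e ∷ B) ≡ interleaveAlt y A ++ e ∷ interleaveAlt (alt y (suc (length A))) B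
interleaveAlt-++ y []      e B = refl
interleaveAlt-++ y (a ∷ A) e B = cong (λ t → y ∷ a ∷ t)
  (trans (interleaveAlt-++ (neg y) A e B)
    (cong (λ z → interleaveAlt (neg y) A ++ e ∷ interleaveAlt z B)
      (trans (alt-alt y 1 (suc (length A))) (cong (alt y) (ℕP.+-comm (suc (length A)) 1)))))

bar-∷ : ∀ s S → bar (s ∷ S) ≡ bar S ++ neg s ∷ []
bar-∷ s S = LP.unfold-reverse (neg s) (map neg S)

length-bar : ∀ S → length (bar S) ≡ length S
length-bar S = trans (LP.length-reverse (map neg S)) (LP.length-map neg S)

bar-interleaveAlt : ∀ x S → bar (interleaveAlt x S) ≡ interleaveAlt (alt x (suc (length S))) (bar S)
bar-interleaveAlt x []      = refl
bar-interleaveAlt x (s ∷ S) = begin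
    bar (x ∷ s ∷ interleaveAlt (neg x) S)
  ≡⟨ bar-∷ x (s ∷ interleaveAlt (neg x) S) ⟩
    bar (s ∷ interleaveAlt (neg x) S) ++ neg x ∷ []
  ≡⟨ cong (_++ neg x ∷ []) (bar-∷ s (interleaveAlt (neg x) S)) ⟩
    (bar (interleaveAlt (neg x) S) ++ neg s ∷ []) ++ neg x ∷ []
  ≡⟨ LP.++-assoc (bar (interleaveAlt (neg x) S)) (neg s ∷ []) (neg x ∷ []) ⟩
    bar (interleaveAlt (neg x) S) ++ neg s ∷ neg x ∷ []
  ≡⟨ cong (_++ neg s ∷ neg x ∷ []) y-start ⟩
    interleaveAlt y (bar S) ++ neg s ∷ neg x ∷ []
  ≡⟨ cong (λ z → interleaveAlt y (bar S) ++ neg s ∷ z ∷ []) (sym y-end) ⟩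
    interleaveAlt y (bar S) ++ neg s ∷ interleaveAlt (alt y (suc (length (bar S)))) []
  ≡˘⟨ interleaveAlt-++ y (bar S) (neg s) [] ⟩
    interleaveAlt y (bar S ++ neg s ∷ [])
  ≡˘⟨ cong (interleaveAlt y) (bar-∷ s S) ⟩
    interleaveAlt y (bar (s ∷ S))
  ∎
  where
  open ≡-Reasoning
  L : ℕ
  L = length S
  y : Sgn
  y = alt x (suc (suc L))
  odd-length : ∀ L → suc L + suc (suc L) ≡ suc (2 * suc L)
  odd-length = solve-∀
  y-start : bar (interleaveAlt (neg x) S) ≡ interleaveAlt y (bar S)
  y-start = trans (bar-interleaveAlt (neg x) S)
    (cong (λ z → interleaveAlt z (bar S)) (trans (alt-alt x 1 (suc L)) (cong (alt x) (ℕP.+-comm (suc L) 1))))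
  y-end : alt y (suc (length (bar S))) ≡ neg x
  y-end = begin
    alt y (suc (length (bar S)))   ≡⟨ cong (λ t → alt y (suc t)) (length-bar S) ⟩
    alt y (suc L)                  ≡⟨ alt-alt x (suc (suc L)) (suc L) ⟩
    alt x (suc L + suc (suc L))    ≡⟨ cong (alt x) (odd-length L) ⟩
    neg (alt x (2 * suc L))        ≡⟨ cong neg (alt-even x (suc L)) ⟩
    neg x                          ∎

folding-interleaves : ∀ N T → IsFolding (suc N) T →
  Σ Sgn λ x → Σ (List Sgn) λ S → IsFolding N S × T ≡ interleaveAlt x S
folding-interleaves zero    _ (fold-suc e fold-zero) = e , [] , fold-zero , refl
folding-interleaves (suc N) _ (fold-suc {S = S} e folded) with folding-interleaves N S folded
... | x , S′ , folded′ , refl = x′ , bar S′ ++ e ∷ S′ , fold-suc e folded′ , sym unfolded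
  where
  L : ℕ
  L = length S′
  x′ : Sgn
  x′ = alt x (suc L)
  even-length : ∀ L → suc L + suc L ≡ 2 * suc L
  even-length = solve-∀
  x-again : alt x′ (suc (length (bar S′))) ≡ x
  x-again = trans (cong (λ t → alt x′ (suc t)) (length-bar S′))
    (trans (alt-alt x (suc L) (suc L)) (trans (cong (alt x) (even-length L)) (alt-even x (suc L))))
  unfolded : interleaveAlt x′ (bar S′ ++ e ∷ S′) ≡ bar (interleaveAlt x S′) ++ e ∷ interleaveAlt x S′
  unfolded = trans (interleaveAlt-++ x′ (bar S′) e S′)
    (cong₂ (λ A z → A ++ e ∷ interleaveAlt z S′) (sym (bar-interleaveAlt x S′)) x-again)

length-interleaveAlt : ∀ x S → length (interleaveAlt x S) ≡ suc (2 * length S)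
length-interleaveAlt x []      = refl
length-interleaveAlt x (s ∷ S) =
  trans (cong (suc ∘ suc) (length-interleaveAlt (neg x) S)) (cong suc (sym (two-suc (length S))))

nth-interleaveAlt-even : ∀ x S j → j ≤ length S → nth (interleaveAlt x S) (2 * j) ≡ alt x j
nth-interleaveAlt-even x []      zero    _       = refl
nth-interleaveAlt-even x (s ∷ S) zero    _       = refl
nth-interleaveAlt-even x (s ∷ S) (suc j) (s≤s j≤) =
  trans (cong (nth (interleaveAlt x (s ∷ S))) (two-suc j))
    (trans (nth-interleaveAlt-even (neg x) S j j≤) (trans (alt-alt x 1 j) (cong (alt x) (ℕP.+-comm j 1))))

nth-interleaveAlt-odd : ∀ x S j → j < length S → nth (interleaveAlt x S) (suc (2 * j)) ≡ nth S j
nth-interleaveAlt-odd x (s ∷ S) zero    _       = refl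
nth-interleaveAlt-odd x (s ∷ S) (suc j) (s≤s j<) =
  trans (cong (λ t → nth (interleaveAlt x (s ∷ S)) (suc t)) (two-suc j)) (nth-interleaveAlt-odd (neg x) S j j<)

cons : Sgn → (ℕ → Sgn) → ℕ → Sgn
cons x c zero    = x
cons x c (suc t) = c t

InitialSegment : List Sgn → (ℕ → Sgn) → Set
InitialSegment S c = ∀ k → k < length S → nth S k ≡ foldSeq c k

initial-interleaveAlt : ∀ x S c → InitialSegment S c → InitialSegment (interleaveAlt x S) (cons x c)
initial-interleaveAlt x S c initial k k< with parity k
... | even j = trans (nth-interleaveAlt-even x S j (ℕP.*-cancelˡ-≤ 2 (ℕP.≤-pred k<′)))
                     (sym (foldSeq-even (cons x c) j))
  where k<′ = subst (2 * j <_) (length-interleaveAlt x S) k<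
... | odd j  = trans (nth-interleaveAlt-odd x S j j<) (trans (initial j j<) (sym (foldSeq-odd (cons x c) j)))
  where j< = halve-< (ℕP.≤-pred (subst (suc (2 * j) <_) (length-interleaveAlt x S) k<))

folding-initial : ∀ N S → IsFolding N S → Σ (ℕ → Sgn) (InitialSegment S)
folding-initial zero    _ fold-zero = (λ _ → plus) , λ k ()
folding-initial (suc N) T folded with folding-interleaves N T folded
... | x , S , folded′ , refl with folding-initial N S folded′
... | c , initial = cons x c , initial-interleaveAlt x S c initial

nth-++ʳ : ∀ P S t → nth (P ++ S) (length P + t) ≡ nth S t
nth-++ʳ []      S t = refl
nth-++ʳ (x ∷ P) S t = nth-++ʳ P S t

nth-++ˡ : ∀ S R t → t < length S → nth (S ++ R) t ≡ nth S t
nth-++ˡ (x ∷ S) R zero    _      = refl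
nth-++ˡ (x ∷ S) R (suc t) (s≤s t<) = nth-++ˡ S R t t<

length-block : ∀ (η : ℤ → Sgn) h L → length (block η h L) ≡ L
length-block η h zero    = refl
length-block η h (suc L) = cong suc (length-block η (h +ℤ pos 1) L)

nth-block : ∀ (η : ℤ → Sgn) h L t → t < L → nth (block η h L) t ≡ η (h +ℤ pos (suc t))
nth-block η h (suc L) zero    _        = refl
nth-block η h (suc L) (suc t) (s≤s t<) =
  trans (nth-block η (h +ℤ pos 1) L t t<) (cong η (ℤP.+-assoc h (pos 1) (pos (suc t))))

folding-window : ∀ η → IsCompleteFolding η → ∀ h L →
  Σ (ℕ → Sgn) λ c → Σ ℕ λ T → ∀ t → t < L → η (h +ℤ pos t) ≡ foldSeq c (T + t)
folding-window η complete h L with complete (h ℤ.- pos 1) L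
... | N , S , folded , before , after , split with folding-initial N S folded
... | c , initial = c , length before , window
  where
  W : List Sgn
  W = block η (h ℤ.- pos 1) L
  shift-back : ∀ (h x : ℤ) → (h ℤ.- pos 1) +ℤ (pos 1 +ℤ x) ≡ h +ℤ x
  shift-back = ℤSolver.solve-∀
  total : length before + (L + length after) ≡ length S
  total = begin
    length before + (L + length after)         ≡˘⟨ cong (λ z → length before + (z + length after)) (length-block η _ L) ⟩
    length before + (length W + length after)  ≡˘⟨ cong (length before +_) (LP.length-++ W) ⟩
    length before + length (W ++ after)        ≡˘⟨ LP.length-++ before ⟩
    length (before ++ W ++ after)              ≡⟨ cong length split ⟩
    length S                                   ∎
    where open ≡-Reasoning
  in-S : ∀ t → t < L → length before + t < length S
  in-S t t<L = subst (length before + t <_) total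
    (ℕP.+-monoʳ-< (length before) (ℕP.≤-trans t<L (ℕP.m≤m+n L (length after))))
  window : ∀ t → t < L → η (h +ℤ pos t) ≡ foldSeq c (length before + t)
  window t t<L = begin
    η (h +ℤ pos t)                                 ≡˘⟨ cong η (shift-back h (pos t)) ⟩
    η ((h ℤ.- pos 1) +ℤ pos (suc t))               ≡˘⟨ nth-block η (h ℤ.- pos 1) L t t<L ⟩
    nth W t                                        ≡˘⟨ nth-++ˡ W after t (subst (t <_) (sym (length-block η _ L)) t<L) ⟩
    nth (W ++ after) t                             ≡˘⟨ nth-++ʳ before (W ++ after) t ⟩
    nth (before ++ W ++ after) (length before + t) ≡⟨ cong (λ z → nth z (length before + t)) split ⟩
    nth S (length before + t)                      ≡⟨ initial (length before + t) (in-S t t<L) ⟩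
    foldSeq c (length before + t)                  ∎
    where open ≡-Reasoning

perpendicular-turn : ∀ d e → (Horizontal d × Vertical e) ⊎ (Vertical d × Horizontal e) →
  e ≡ turnDir (turn d e) ⊙ d
perpendicular-turn .east  .north (inj₁ (h-east , v-north)) = refl
perpendicular-turn .east  .south (inj₁ (h-east , v-south)) = refl
perpendicular-turn .west  .north (inj₁ (h-west , v-north)) = refl
perpendicular-turn .west  .south (inj₁ (h-west , v-south)) = refl
perpendicular-turn .north .east  (inj₂ (v-north , h-east)) = refl
perpendicular-turn .north .west  (inj₂ (v-north , h-west)) = refl
perpendicular-turn .south .east  (inj₂ (v-south , h-east)) = refl
perpendicular-turn .south .west  (inj₂ (v-south , h-west)) = refl

direction-heading : ∀ C → (∀ i → Perp (C i) (C (i +ℤ pos 1))) → ∀ h t →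
  dir (C (h +ℤ pos t)) ≡ heading (λ s → assoc C (h +ℤ pos s)) t ⊙ dir (C h)
direction-heading C perp h zero    = cong (dir ∘ C) (ℤP.+-identityʳ h)
direction-heading C perp h (suc t) = begin
  dir (C (h +ℤ pos (suc t)))                        ≡˘⟨ cong (dir ∘ C) next ⟩
  dir (C ((h +ℤ pos t) +ℤ pos 1))                   ≡⟨ perpendicular-turn _ _ (perp (h +ℤ pos t)) ⟩
  turnDir (η t) ⊙ dir (C (h +ℤ pos t))              ≡⟨ cong (turnDir (η t) ⊙_) (direction-heading C perp h t) ⟩
  turnDir (η t) ⊙ (heading η t ⊙ dir (C h))         ≡˘⟨ ⊙-assoc (turnDir (η t)) (heading η t) (dir (C h)) ⟩
  heading η (suc t) ⊙ dir (C h)                     ∎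
  where
  open ≡-Reasoning
  η : ℕ → Sgn
  η = λ s → assoc C (h +ℤ pos s)
  next : (h +ℤ pos t) +ℤ pos 1 ≡ h +ℤ pos (suc t)
  next = trans (ℤP.+-assoc h (pos t) (pos 1)) (cong (λ m → h +ℤ pos m) (ℕP.+-comm t 1))

directions-from-headings : ∀ C → (∀ i → Perp (C i) (C (i +ℤ pos 1))) → ∀ h (a : ℕ → Sgn) T L →
  (∀ t → t < L → assoc C (h +ℤ pos t) ≡ a (T + t)) → ∀ g x y → x ≤ L → y ≤ L →
  heading a (T + y) ≡ g ⊙ heading a (T + x) → dir (C (h +ℤ pos y)) ≡ g ⊙ dir (C (h +ℤ pos x))
directions-from-headings C perp h a T L window g x y x≤L y≤L rotated = begin
  dir (C (h +ℤ pos y))                ≡⟨ direction-heading C perp h y ⟩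
  heading η y ⊙ dir (C h)             ≡⟨ cong (_⊙ dir (C h)) relative ⟩
  (g ⊙ heading η x) ⊙ dir (C h)       ≡⟨ ⊙-assoc g (heading η x) (dir (C h)) ⟩
  g ⊙ (heading η x ⊙ dir (C h))       ≡˘⟨ cong (g ⊙_) (direction-heading C perp h x) ⟩
  g ⊙ dir (C (h +ℤ pos x))            ∎
  where
  open ≡-Reasoning
  η : ℕ → Sgn
  η = λ s → assoc C (h +ℤ pos s)
  aligned : ∀ t → t ≤ L → heading η t ⊙ heading a T ≡ heading a (T + t)
  aligned t t≤L = trans (cong (_⊙ heading a T) (heading-cong t (λ s s<t → window s (ℕP.<-≤-trans s<t t≤L))))
                        (sym (heading-+ a T t))
  relative : heading η y ≡ g ⊙ heading η x
  relative = ⊙-cancelʳ (heading a T) (begin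
    heading η y ⊙ heading a T          ≡⟨ aligned y y≤L ⟩
    heading a (T + y)                  ≡⟨ rotated ⟩
    g ⊙ heading a (T + x)              ≡˘⟨ cong (g ⊙_) (aligned x x≤L) ⟩
    g ⊙ (heading η x ⊙ heading a T)    ≡˘⟨ ⊙-assoc g (heading η x) (heading a T) ⟩
    (g ⊙ heading η x) ⊙ heading a T    ∎)

moveSegment : (Point → Point) → (Dir → Dir) → Segment → Segment
moveSegment φ ρ s = seg (φ (start s)) (ρ (dir s))

Compatible : (Point → Point) → (Dir → Dir) → Set
Compatible φ ρ = ∀ x d → φ (x ⊕ dvec d) ≡ φ x ⊕ dvec (ρ d)

Connected : (ℤ → Segment) → Set
Connected C = ∀ i → terminal (C i) ≡ start (C (i +ℤ pos 1))

motion-block : ∀ C → Connected C → ∀ φ ρ → Compatible φ ρ → ∀ n p q →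
  start (C (q +ℤ pos 1)) ≡ φ (start (C (p +ℤ pos 1))) →
  (∀ l → l < n → dir (C (q +ℤ pos (suc l))) ≡ ρ (dir (C (p +ℤ pos (suc l))))) →
  map (moveSegment φ ρ) (block C p n) ≡ block C q n
motion-block C conn φ ρ compatible zero    p q starts dirs = refl
motion-block C conn φ ρ compatible (suc n) p q starts dirs =
  cong₂ _∷_ (cong₂ seg (sym starts) (sym (dirs 0 (s≤s z≤n))))
    (motion-block C conn φ ρ compatible n (p +ℤ pos 1) (q +ℤ pos 1) next-start next-dirs)
  where
  next-start : start (C ((q +ℤ pos 1) +ℤ pos 1)) ≡ φ (start (C ((p +ℤ pos 1) +ℤ pos 1)))
  next-start = begin
    start (C ((q +ℤ pos 1) +ℤ pos 1))                           ≡˘⟨ conn (q +ℤ pos 1) ⟩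
    start (C (q +ℤ pos 1)) ⊕ dvec (dir (C (q +ℤ pos 1)))
      ≡⟨ cong₂ (λ x d → x ⊕ dvec d) starts (dirs 0 (s≤s z≤n)) ⟩
    φ (start (C (p +ℤ pos 1))) ⊕ dvec (ρ (dir (C (p +ℤ pos 1))))
      ≡˘⟨ compatible (start (C (p +ℤ pos 1))) (dir (C (p +ℤ pos 1))) ⟩
    φ (terminal (C (p +ℤ pos 1)))                               ≡⟨ cong φ (conn (p +ℤ pos 1)) ⟩
    φ (start (C ((p +ℤ pos 1) +ℤ pos 1)))                       ∎
    where open ≡-Reasoning
  next-dirs : ∀ l → l < n →
    dir (C ((q +ℤ pos 1) +ℤ pos (suc l))) ≡ ρ (dir (C ((p +ℤ pos 1) +ℤ pos (suc l))))
  next-dirs l l<n = subst₂ (λ x y → dir (C x) ≡ ρ (dir (C y)))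
    (sym (ℤP.+-assoc q (pos 1) (pos (suc l)))) (sym (ℤP.+-assoc p (pos 1) (pos (suc l)))) (dirs (suc l) (s≤s l<n))

negate : Point → Point
negate (a , b) = (ℤ.- a , ℤ.- b)

dvec-opp : ∀ d → dvec (opp d) ≡ negate (dvec d)
dvec-opp east  = refl
dvec-opp north = refl
dvec-opp west  = refl
dvec-opp south = refl

translation-compatible : ∀ v → Compatible (_⊕ v) (λ d → d)
translation-compatible (v₁ , v₂) (x₁ , x₂) d =
  cong₂ _,_ (swap x₁ (proj₁ (dvec d)) v₁) (swap x₂ (proj₂ (dvec d)) v₂)
  where
  swap : ∀ (x e v : ℤ) → (x +ℤ e) +ℤ v ≡ (x +ℤ v) +ℤ e
  swap = ℤSolver.solve-∀

reflection-compatible : ∀ c → Compatible (c ⊖_) opp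
reflection-compatible (c₁ , c₂) (x₁ , x₂) d =
  trans (cong₂ _,_ (reflect c₁ x₁ (proj₁ (dvec d))) (reflect c₂ x₂ (proj₂ (dvec d))))
    (cong ((c₁ ℤ.- x₁ , c₂ ℤ.- x₂) ⊕_) (sym (dvec-opp d)))
  where
  reflect : ∀ (c x e : ℤ) → c ℤ.- (x +ℤ e) ≡ (c ℤ.- x) +ℤ (ℤ.- e)
  reflect = ℤSolver.solve-∀

parallel-blocks : ∀ C → Connected C → ∀ p q n →
  (∀ l → l < n → dir (C (q +ℤ pos (suc l))) ≡ dir (C (p +ℤ pos (suc l)))) →
  Parallel (block C p n) (block C q n)
parallel-blocks C conn p q n dirs =
  v , motion-block C conn (_⊕ v) (λ d → d) (translation-compatible v) n p q
        (difference (start (C (p +ℤ pos 1))) (start (C (q +ℤ pos 1)))) dirs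
  where
  v : Point
  v = start (C (q +ℤ pos 1)) ⊖ start (C (p +ℤ pos 1))
  difference : ∀ x y → y ≡ x ⊕ (y ⊖ x)
  difference (x₁ , x₂) (y₁ , y₂) = cong₂ _,_ (diff x₁ y₁) (diff x₂ y₂)
    where
    diff : ∀ (x y : ℤ) → y ≡ x +ℤ (y ℤ.- x)
    diff = ℤSolver.solve-∀

opposite-blocks : ∀ C → Connected C → ∀ p q n →
  (∀ l → l < n → dir (C (q +ℤ pos (suc l))) ≡ opp (dir (C (p +ℤ pos (suc l))))) →
  Opposite (block C p n) (block C q n)
opposite-blocks C conn p q n dirs =
  c , motion-block C conn (c ⊖_) opp (reflection-compatible c) n p q
        (centre (start (C (p +ℤ pos 1))) (start (C (q +ℤ pos 1)))) dirs
  where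
  c : Point
  c = start (C (q +ℤ pos 1)) ⊕ start (C (p +ℤ pos 1))
  centre : ∀ x y → y ≡ (y ⊕ x) ⊖ x
  centre (x₁ , x₂) (y₁ , y₂) = cong₂ _,_ (cancel x₁ y₁) (cancel x₂ y₂)
    where
    cancel : ∀ (x y : ℤ) → y ≡ (y +ℤ x) ℤ.- x
    cancel = ℤSolver.solve-∀

common-base : ∀ i j → Σ ℤ λ B → Σ ℕ λ a → Σ ℕ λ b → i ≡ B +ℤ pos a × j ≡ B +ℤ pos b
common-base i j with ℤP.+∣i∣≡i⊎+∣i∣≡-i (j ℤ.- i)
... | inj₁ up   = i , 0 , ℤ.∣ j ℤ.- i ∣ , sym (ℤP.+-identityʳ i) , trans (difference i j) (cong (i +ℤ_) (sym up))
  where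
  difference : ∀ (i j : ℤ) → j ≡ i +ℤ (j ℤ.- i)
  difference = ℤSolver.solve-∀
... | inj₂ down = j , ℤ.∣ j ℤ.- i ∣ , 0 , trans (difference i j) (cong (j +ℤ_) (sym down)) , sym (ℤP.+-identityʳ j)
  where
  difference : ∀ (i j : ℤ) → i ≡ j +ℤ ℤ.- (j ℤ.- i)
  difference = ℤSolver.solve-∀

RotatedCopy : (ℤ → Segment) → ℕ → ℤ → ℤ → Dir → Set
RotatedCopy C n i j g = Σ ℕ λ k → k + n ≤ 88 * n ×
  (∀ l → l < n → dir (C ((j +ℤ pos k) +ℤ pos (suc l))) ≡ g ⊙ dir (C (i +ℤ pos (suc l))))

-- The main lemma transported to complete folding curves: both copies exist
-- within a window of a folding function containing the two blocks.
rotated-copies : ∀ C → IsCompleteFoldingCurve C → ∀ n i j → RotatedCopy C n i j east × RotatedCopy C n i j west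
rotated-copies C (curve , folding) n i j with common-base i j
... | B , a , b , refl , refl = from-window (folding-window (assoc C) folding B L)
  where
  L : ℕ
  L = (a + n) + (b + 88 * n)
  from-window : (Σ (ℕ → Sgn) λ c → Σ ℕ λ T → ∀ t → t < L → assoc C (B +ℤ pos t) ≡ foldSeq c (T + t)) →
    RotatedCopy C n (B +ℤ pos a) (B +ℤ pos b) east × RotatedCopy C n (B +ℤ pos a) (B +ℤ pos b) west
  from-window (c , T , window) = transfer {east} (proj₁ (main-lemma c n (T + a) (T + b)))
                               , transfer {west} (proj₂ (main-lemma c n (T + a) (T + b)))
    where
    transfer : ∀ {g} → Copy c n (T + a) (T + b) g → RotatedCopy C n (B +ℤ pos a) (B +ℤ pos b) g
    transfer {g} (k , k≤ , copy) = k , k≤ , λ l l<n →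
      subst₂ (λ u w → dir (C u) ≡ g ⊙ dir (C w)) (sym (index-j l)) (sym (index-i l))
        (directions-from-headings C (IsCompleteCurve.perpendicular curve) B (foldSeq c) T L window g
          (a + suc l) (b + k + suc l) (x≤L l l<n) (y≤L l l<n)
          (subst₂ (λ u w → heading (foldSeq c) u ≡ g ⊙ heading (foldSeq c) w)
            (offset-j l) (ℕP.+-assoc T a (suc l)) (copy l l<n)))
      where
      index-i : ∀ l → (B +ℤ pos a) +ℤ pos (suc l) ≡ B +ℤ pos (a + suc l)
      index-i l = ℤP.+-assoc B (pos a) (pos (suc l))
      index-j : ∀ l → ((B +ℤ pos b) +ℤ pos k) +ℤ pos (suc l) ≡ B +ℤ pos (b + k + suc l)
      index-j l = trans (cong (_+ℤ pos (suc l)) (ℤP.+-assoc B (pos b) (pos k))) (ℤP.+-assoc B (pos (b + k)) (pos (suc l)))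
      offset-j : ∀ l → T + b + k + suc l ≡ T + (b + k + suc l)
      offset-j l = trans (cong (_+ suc l) (ℕP.+-assoc T b k)) (ℕP.+-assoc T (b + k) (suc l))
      x≤L : ∀ l → l < n → a + suc l ≤ L
      x≤L l l<n = ℕP.≤-trans (ℕP.+-monoʳ-≤ a l<n) (ℕP.m≤m+n (a + n) _)
      y≤L : ∀ l → l < n → b + k + suc l ≤ L
      y≤L l l<n = begin
        b + k + suc l    ≡⟨ ℕP.+-assoc b k (suc l) ⟩
        b + (k + suc l)  ≤⟨ ℕP.+-monoʳ-≤ b (ℕP.≤-trans (ℕP.+-monoʳ-≤ k l<n) k≤) ⟩
        b + 88 * n       ≤⟨ ℕP.m≤n+m (b + 88 * n) (a + n) ⟩
        L                ∎
        where open ℕP.≤-Reasoning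

proposition2p6 : (C : ℤ → Segment) → IsCompleteFoldingCurve C →
    (n : ℕ) (i j : ℤ) →
    (Σ ℕ λ k → (k + n ≤ 88 * n) × Parallel (block C i n) (block C (j +ℤ pos k) n))
    × (Σ ℕ λ k → (k + n ≤ 88 * n) × Opposite (block C i n) (block C (j +ℤ pos k) n))
proposition2p6 C complete n i j with rotated-copies C complete n i j
... | (k₁ , k₁≤ , same) , (k₂ , k₂≤ , reversed) =
  (k₁ , k₁≤ , parallel-blocks C connected i (j +ℤ pos k₁) n same) ,
  (k₂ , k₂≤ , opposite-blocks C connected i (j +ℤ pos k₂) n reversed)
  where
  connected : Connected C
  connected = IsCompleteCurve.connected (proj₁ complete)
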